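{- Let $G$ be a graph, $u,v$ distinct non-adjacent vertices, $k$ a positive integer, $\mathbf{S}_{uv}(G)$ the family of minimal $uv$-separators of $G$, and $H_{uv}$ the graph with vertex set $\mathbf{S}_{uv}(G)$ in which distinct $S_i,S_j$ are adjacent iff $|S_i\cup S_j|\le k$. For any two $uv$-separators $S_a,S_b$ of $G$ with $|S_a|,|S_b|\le k$, $S_a$ can be reconfigured into $S_b$ under $k$-TAR if and only if there exist minimal $uv$-separators $S_a'\subseteq S_a$ and $S_b'\subseteq S_b$ joined by a path in $H_{uv}$.
   Context: A set $S\subseteq V(G)\setminus\{u,v\}$ is a $uv$-separator if $u$ and $v$ lie in different components of $G-S$; minimal if no proper subset is one. Under $k$-TAR, $uv$-separators $S,S'$ are adjacent if $|S\triangle S'|=1$ and $\max(|S|,|S'|)\le k$; $S_a$ can be reconfigured into $S_b$ if there is a sequence of $uv$-separators from $S_a$ to $S_b$ with consecutive ones adjacent. -}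

module Defs where

open import Data.Bool using (Bool; true; false)
open import Data.Nat using (ℕ; _≤_; _⊔_)
open import Data.Fin using (Fin)
open import Data.Fin.Subset using (Subset; _∈_; _∉_; _⊆_; _⊂_; _∪_; _─_; ∣_∣)
open import Data.Product using (_×_; ∃)
open import Relation.Nullary using (¬_)
open import Relation.Binary.PropositionalEquality using (_≡_; _≢_)
open import Relation.Binary.Construct.Closure.ReflexiveTransitive using (Star)

record Graph (n : ℕ) : Set where
  field
    adj    : Fin n → Fin n → Bool
    sym    : ∀ x y → adj x y ≡ adj y x
    irrefl : ∀ x → adj x x ≡ false

open Graph public

module _ {n : ℕ} (G : Graph n) where

  -- Reach S x y : y is reachable from x by a walk in G - S
  -- (x itself is the start; every later vertex avoids S).
  data Reach (S : Subset n) (x : Fin n) : Fin n → Set where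
    here : Reach S x x
    step : ∀ {y z} → Reach S x y → adj G y z ≡ true → z ∉ S → Reach S x z

  IsSeparator : Fin n → Fin n → Subset n → Set
  IsSeparator u v S = u ∉ S × v ∉ S × ¬ Reach S u v

  IsMinimalSeparator : Fin n → Fin n → Subset n → Set
  IsMinimalSeparator u v S =
    IsSeparator u v S × (∀ S′ → S′ ⊂ S → ¬ IsSeparator u v S′)

  _△_ : Subset n → Subset n → Subset n
  S △ T = (S ─ T) ∪ (T ─ S)

  TARStep : ℕ → Fin n → Fin n → Subset n → Subset n → Set
  TARStep k u v S T =
    IsSeparator u v S × IsSeparator u v T ×
    ∣ S △ T ∣ ≡ 1 × (∣ S ∣ ⊔ ∣ T ∣) ≤ k

  Reconfigurable : ℕ → Fin n → Fin n → Subset n → Subset n → Set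
  Reconfigurable k u v = Star (TARStep k u v)

  HEdge : ℕ → Fin n → Fin n → Subset n → Subset n → Set
  HEdge k u v S T =
    IsMinimalSeparator u v S × IsMinimalSeparator u v T ×
    S ≢ T × ∣ S ∪ T ∣ ≤ k

  HPath : ℕ → Fin n → Fin n → Subset n → Subset n → Set
  HPath k u v = Star (HEdge k u v)

module Submission where

-- (⇐) Whenever A ⊆ B are separators with ∣ B ∣ ≤ k, adding the elements of
-- B ∖ A one at a time passes only through separators of size ≤ k (every set
-- sandwiched between two separators is one), so A and B are k-TAR
-- reconfigurable in both directions.  An H_uv-edge M — M′ is therefore the
-- detour M → M ∪ M′ → M′, and S_a ⇝ S_a′ ⇝ S_b′ ⇝ S_b follows.
--
-- (⇒) Two sets at symmetric-difference distance 1 are comparable.  Hence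
-- along a TAR step S → S′ a minimal separator M ⊆ S either stays inside S′,
-- or S′ ⊆ S and any minimal M′ ⊆ S′ satisfies M ∪ M′ ⊆ S, so ∣ M ∪ M′ ∣ ≤ k
-- and M = M′ or M — M′ is an edge of H_uv.  Following a minimal separator of
-- S_a along the reconfiguration sequence yields the H_uv-path.
--
-- Constructively, "every separator contains a minimal one" needs the
-- separator property to be decidable; this rests on deciding reachability in
-- G - S by saturating the set of vertices reached from u.

open import Defs
open import Data.Bool using (false)
open import Data.Nat using (ℕ; _≤_)
open import Data.Fin using (Fin)
open import Data.Fin.Subset using (Subset; _⊆_; ∣_∣)
open import Data.Product using (_×_; Σ-syntax)
open import Function.Bundles using (_⇔_)
open import Relation.Binary.PropositionalEquality using (_≡_; _≢_)

open import Data.Bool as Bool using (true)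
open import Data.Nat using (suc; _<_; _+_; s≤s)
open import Data.Nat.Properties as ℕ using ()
open import Data.Fin as Fin using ()
open import Data.Fin.Properties using (any?)
open import Data.Fin.Subset using (_∈_; _∉_; _⊂_; _∪_; _─_; _-_; ⁅_⁆; inside; outside)
open import Data.Fin.Subset.Properties
open import Data.Vec using (_∷_; [])
open import Data.Vec.Properties using (≡-dec)
open import Data.Vec using (here)
open import Data.Product using (∃; ∃₂; _,_)
open import Data.Sum using (_⊎_; inj₁; inj₂; [_,_])
open import Data.Empty using (⊥-elim)
open import Function using (id)
open import Function.Bundles using (mk⇔)
open import Relation.Nullary using (¬_; Dec; yes; no; ¬?)
open import Relation.Nullary.Decidable using (_×-dec_; decidable-stable)
open import Relation.Binary.PropositionalEquality using (refl; subst; cong) renaming (sym to ≡-sym)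
open import Relation.Binary.Construct.Closure.ReflexiveTransitive
  using (Star; ε; _◅_; _◅◅_; gmap; reverse)

module _ {m : ℕ} where

  -- Symmetric difference; definitionally the relation _△_ of Defs, which
  -- carries an (unused) graph parameter.
  _⊖_ : Subset m → Subset m → Subset m
  S ⊖ T = (S ─ T) ∪ (T ─ S)

  ∪-least : {P Q R : Subset m} → P ⊆ R → Q ⊆ R → P ∪ Q ⊆ R
  ∪-least {P} {Q} P⊆R Q⊆R x∈P∪Q = [ P⊆R , Q⊆R ] (x∈p∪q⁻ P Q x∈P∪Q)

  ∉-∪ : {P Q : Subset m} {x : Fin m} → x ∉ P → x ∉ Q → x ∉ P ∪ Q
  ∉-∪ {P} {Q} x∉P x∉Q x∈P∪Q = [ x∉P , x∉Q ] (x∈p∪q⁻ P Q x∈P∪Q)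

  ∈⇒1≤∣p∣ : {P : Subset m} {x : Fin m} → x ∈ P → 1 ≤ ∣ P ∣
  ∈⇒1≤∣p∣ {P} {x} x∈P = subst (_≤ ∣ P ∣) (∣⁅x⁆∣≡1 x) (p⊆q⇒∣p∣≤∣q∣ singleton⊆P)
    where
    singleton⊆P : ⁅ x ⁆ ⊆ P
    singleton⊆P y∈⁅x⁆ = subst (_∈ P) (≡-sym (x∈⁅y⁆⇒x≡y x y∈⁅x⁆)) x∈P

  ∣p∣≤1⇒unique : {P : Subset m} {x y : Fin m} → x ∈ P → y ∈ P → ∣ P ∣ ≤ 1 → x ≡ y
  ∣p∣≤1⇒unique {P} {x} {y} x∈P y∈P ∣P∣≤1 with x Fin.≟ y
  ... | yes x≡y = x≡y
  ... | no x≢y with ℕ.≤-trans (ℕ.<-≤-trans (s≤s (∈⇒1≤∣p∣ y∈P-x)) (x∈p⇒∣p-x∣<∣p∣ x∈P)) ∣P∣≤1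
    where
    y∈P-x : y ∈ P - x
    y∈P-x = x∈p∧x≢y⇒x∈p-y y∈P (λ y≡x → x≢y (≡-sym y≡x))
  ...   | s≤s ()

  one-apart⇒comparable : (S T : Subset m) → ∣ S ⊖ T ∣ ≡ 1 → S ⊆ T ⊎ T ⊆ S
  one-apart⇒comparable S T apart with any? (λ x → (x ∈? S) ×-dec ¬? (x ∈? T))
  ... | no none = inj₁ λ {y} y∈S → decidable-stable (y ∈? T) (λ y∉T → none (y , y∈S , y∉T))
  ... | yes (x , x∈S , x∉T) = inj₂ T⊆S
    where
    T⊆S : T ⊆ S
    T⊆S {y} y∈T = decidable-stable (y ∈? S) λ y∉S → x∉T (subst (_∈ T) (≡-sym (x≡y y∉S)) y∈T)
      where
      x≡y : y ∉ S → x ≡ y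
      x≡y y∉S = ∣p∣≤1⇒unique (x∈p∪q⁺ (inj₁ (x∈p∧x∉q⇒x∈p─q x∈S x∉T)))
                             (x∈p∪q⁺ (inj₂ (x∈p∧x∉q⇒x∈p─q y∈T y∉S)))
                             (ℕ.≤-reflexive apart)

  ∉⇒∣p∣<m : {P : Subset m} {x : Fin m} → x ∉ P → ∣ P ∣ < m
  ∉⇒∣p∣<m {P} {x} x∉P = subst (∣ P ∣ <_) (∣⊤∣≡n m) (p⊂q⇒∣p∣<∣q∣ (⊆⊤ , x , ∈⊤ , x∉P))

  ∉⇒∣p∣<∣p∪⁅x⁆∣ : {P : Subset m} {x : Fin m} → x ∉ P → ∣ P ∣ < ∣ P ∪ ⁅ x ⁆ ∣
  ∉⇒∣p∣<∣p∪⁅x⁆∣ {P} {x} x∉P =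
    p⊂q⇒∣p∣<∣q∣ (p⊆p∪q ⁅ x ⁆ , x , x∈p∪q⁺ (inj₂ (x∈⁅x⁆ x)) , x∉P)

  ⊂⇒⊆-delete : {Q P : Subset m} → Q ⊂ P → ∃ λ x → x ∈ P × Q ⊆ P - x
  ⊂⇒⊆-delete (Q⊆P , x , x∈P , x∉Q) =
    x , x∈P , λ y∈Q → x∈p∧x≢y⇒x∈p-y (Q⊆P y∈Q) λ y≡x → x∉Q (subst (_∈ _) y≡x y∈Q)

∣p⊖p∣≡0 : ∀ {m} (P : Subset m) → ∣ P ⊖ P ∣ ≡ 0
∣p⊖p∣≡0 []            = refl
∣p⊖p∣≡0 (inside ∷ P)  = ∣p⊖p∣≡0 P
∣p⊖p∣≡0 (outside ∷ P) = ∣p⊖p∣≡0 P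

IntervalStep : ∀ {m} → Subset m → Subset m → Subset m → Subset m → Set
IntervalStep A B X Y = (A ⊆ X × X ⊆ B) × (A ⊆ Y × Y ⊆ B) × ∣ X ⊖ Y ∣ ≡ 1

lift-interval-step : ∀ {m} {A B X Y : Subset m} a b → a ∷ A ⊆ b ∷ B →
  IntervalStep A B X Y → IntervalStep (a ∷ A) (b ∷ B) (a ∷ X) (a ∷ Y)
lift-interval-step inside  inside  _ ((A⊆X , X⊆B) , (A⊆Y , Y⊆B) , apart) =
  (s⊆s A⊆X , s⊆s X⊆B) , (s⊆s A⊆Y , s⊆s Y⊆B) , apart
lift-interval-step outside inside  _ ((A⊆X , X⊆B) , (A⊆Y , Y⊆B) , apart) =
  (s⊆s A⊆X , out⊆ X⊆B) , (s⊆s A⊆Y , out⊆ Y⊆B) , apart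
lift-interval-step outside outside _ ((A⊆X , X⊆B) , (A⊆Y , Y⊆B) , apart) =
  (s⊆s A⊆X , s⊆s X⊆B) , (s⊆s A⊆Y , s⊆s Y⊆B) , apart
lift-interval-step inside  outside aA⊆bB _ with aA⊆bB here
... | ()

interval-chain : ∀ {m} {A B : Subset m} → A ⊆ B → Star (IntervalStep A B) A B
interval-chain {A = []} {[]} _ = ε
interval-chain {A = inside ∷ A} {inside ∷ B} aA⊆bB =
  gmap (inside ∷_) (lift-interval-step inside inside aA⊆bB) (interval-chain (drop-∷-⊆ aA⊆bB))
interval-chain {A = outside ∷ A} {outside ∷ B} aA⊆bB =
  gmap (outside ∷_) (lift-interval-step outside outside aA⊆bB) (interval-chain (drop-∷-⊆ aA⊆bB))
interval-chain {A = outside ∷ A} {inside ∷ B} aA⊆bB =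
  gmap (outside ∷_) (lift-interval-step outside inside aA⊆bB) (interval-chain A⊆B)
  ◅◅ add-head ◅ ε
  where
  A⊆B : A ⊆ B
  A⊆B = drop-∷-⊆ aA⊆bB
  add-head : IntervalStep (outside ∷ A) (inside ∷ B) (outside ∷ B) (inside ∷ B)
  add-head = (s⊆s A⊆B , out⊆ id) , (out⊆ A⊆B , id) , cong suc (∣p⊖p∣≡0 B)
interval-chain {A = inside ∷ A} {outside ∷ B} aA⊆bB with aA⊆bB here
... | ()

module _ {n : ℕ} (G : Graph n) where

  module Saturation (S : Subset n) (u : Fin n) where

    Sound : Subset n → Set
    Sound P = ∀ {x} → x ∈ P → Reach G S u x

    Closed : Subset n → Set
    Closed P = ∀ {y z} → y ∈ P → adj G y z ≡ true → z ∉ S → z ∈ P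

    Exit : Subset n → Set
    Exit P = ∃₂ λ y z → y ∈ P × adj G y z ≡ true × z ∉ S × z ∉ P

    exit? : (P : Subset n) → Dec (Exit P)
    exit? P = any? λ y → any? λ z →
      (y ∈? P) ×-dec (adj G y z Bool.≟ true) ×-dec ¬? (z ∈? S) ×-dec ¬? (z ∈? P)

    no-exit⇒closed : (P : Subset n) → ¬ Exit P → Closed P
    no-exit⇒closed P none {y} {z} y∈P yz z∉S =
      decidable-stable (z ∈? P) λ z∉P → none (y , z , y∈P , yz , z∉S , z∉P)

    closed⇒reach-⊆ : {P : Subset n} → u ∈ P → Closed P → ∀ {x} → Reach G S u x → x ∈ P
    closed⇒reach-⊆ u∈P closed here           = u∈P
    closed⇒reach-⊆ u∈P closed (step r yz z∉S) = closed (closed⇒reach-⊆ u∈P closed r) yz z∉S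

    -- Each round adds a vertex, so fuel + ∣ P ∣ ≥ n rounds suffice.
    saturate : (fuel : ℕ) (P : Subset n) → n ≤ fuel + ∣ P ∣ → u ∈ P → Sound P →
               Σ[ Q ∈ Subset n ] (u ∈ Q × Sound Q × Closed Q)
    saturate fuel P bound u∈P sound with exit? P
    ... | no none = P , u∈P , sound , no-exit⇒closed P none
    saturate 0 P bound u∈P sound | yes (_ , _ , _ , _ , _ , z∉P) =
      ⊥-elim (ℕ.<-irrefl refl (ℕ.<-≤-trans (∉⇒∣p∣<m z∉P) bound))
    saturate (suc fuel) P bound u∈P sound | yes (y , z , y∈P , yz , z∉S , z∉P) =
      saturate fuel (P ∪ ⁅ z ⁆) bound′ (p⊆p∪q ⁅ z ⁆ u∈P) sound′
      where
      bound′ : n ≤ fuel + ∣ P ∪ ⁅ z ⁆ ∣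
      bound′ = ℕ.≤-trans bound (ℕ.≤-trans (ℕ.≤-reflexive (≡-sym (ℕ.+-suc fuel ∣ P ∣)))
                                          (ℕ.+-monoʳ-≤ fuel (∉⇒∣p∣<∣p∪⁅x⁆∣ z∉P)))
      sound′ : Sound (P ∪ ⁅ z ⁆)
      sound′ x∈P∪z with x∈p∪q⁻ P ⁅ z ⁆ x∈P∪z
      ... | inj₁ x∈P  = sound x∈P
      ... | inj₂ x∈⁅z⁆ = subst (Reach G S u) (≡-sym (x∈⁅y⁆⇒x≡y z x∈⁅z⁆)) (step (sound y∈P) yz z∉S)

    reach? : (x : Fin n) → Dec (Reach G S u x)
    reach? x with saturate n ⁅ u ⁆ (ℕ.m≤m+n n _) (x∈⁅x⁆ u) start-sound
      where
      start-sound : Sound ⁅ u ⁆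
      start-sound y∈⁅u⁆ = subst (Reach G S u) (≡-sym (x∈⁅y⁆⇒x≡y u y∈⁅u⁆)) here
    ... | Q , u∈Q , sound , closed with x ∈? Q
    ... | yes x∈Q = yes (sound x∈Q)
    ... | no x∉Q  = no λ r → x∉Q (closed⇒reach-⊆ u∈Q closed r)

  reach-antitone : {S T : Subset n} {u x : Fin n} → T ⊆ S → Reach G S u x → Reach G T u x
  reach-antitone T⊆S here              = here
  reach-antitone T⊆S (step r yz z∉S) = step (reach-antitone T⊆S r) yz (λ z∈T → z∉S (T⊆S z∈T))

  module _ (u v : Fin n) where

    separator? : (S : Subset n) → Dec (IsSeparator G u v S)
    separator? S = ¬? (u ∈? S) ×-dec ¬? (v ∈? S) ×-dec ¬? (Saturation.reach? S u v)

    separator-superset : {T S : Subset n} → T ⊆ S → IsSeparator G u v T →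
                         u ∉ S → v ∉ S → IsSeparator G u v S
    separator-superset T⊆S (_ , _ , T-separates) u∉S v∉S =
      u∉S , v∉S , λ r → T-separates (reach-antitone T⊆S r)

    separator-between : {A X B : Subset n} → A ⊆ X → X ⊆ B →
      IsSeparator G u v A → IsSeparator G u v B → IsSeparator G u v X
    separator-between A⊆X X⊆B sepA (u∉B , v∉B , _) =
      separator-superset A⊆X sepA (λ u∈X → u∉B (X⊆B u∈X)) (λ v∈X → v∉B (X⊆B v∈X))

    separator-∪ : {M M′ : Subset n} → IsSeparator G u v M → IsSeparator G u v M′ →
                  IsSeparator G u v (M ∪ M′)
    separator-∪ sepM@(u∉M , v∉M , _) (u∉M′ , v∉M′ , _) =
      separator-superset (p⊆p∪q _) sepM (∉-∪ u∉M u∉M′) (∉-∪ v∉M v∉M′)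

    -- Every separator contains a minimal one: delete removable vertices
    -- while any remain.
    minimal-inside : (S : Subset n) → IsSeparator G u v S →
                     Σ[ M ∈ Subset n ] (IsMinimalSeparator G u v M × M ⊆ S)
    minimal-inside S = shrinking (suc ∣ S ∣) S ℕ.≤-refl
      where
      shrinking : (fuel : ℕ) (S : Subset n) → ∣ S ∣ < fuel → IsSeparator G u v S →
                  Σ[ M ∈ Subset n ] (IsMinimalSeparator G u v M × M ⊆ S)
      shrinking (suc fuel) S ∣S∣≤fuel sepS with any? (λ x → (x ∈? S) ×-dec separator? (S - x))
      ... | yes (x , x∈S , sepS-x) with shrinking fuel (S - x)
            (ℕ.<-≤-trans (x∈p⇒∣p-x∣<∣p∣ x∈S) (ℕ.≤-pred ∣S∣≤fuel)) sepS-x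
      ...   | M , minM , M⊆S-x = M , minM , λ y∈M → p─q⊆p S ⁅ x ⁆ (M⊆S-x y∈M)
      shrinking (suc fuel) S ∣S∣≤fuel sepS | no none = S , (sepS , minimal) , id
        where
        minimal : ∀ S′ → S′ ⊂ S → ¬ IsSeparator G u v S′
        minimal S′ S′⊂S sepS′ with ⊂⇒⊆-delete S′⊂S
        ... | x , x∈S , S′⊆S-x =
          none (x , x∈S , separator-between S′⊆S-x (p─q⊆p S ⁅ x ⁆) sepS′ sepS)

    module _ (k : ℕ) where

      tar-sym : {S T : Subset n} → TARStep G k u v S T → TARStep G k u v T S
      tar-sym {S} {T} (sepS , sepT , apart , size) =
        sepT , sepS , subst (_≡ 1) (cong ∣_∣ (∪-comm (S ─ T) (T ─ S))) apart ,
        subst (_≤ k) (ℕ.⊔-comm ∣ S ∣ ∣ T ∣) size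

      grow : {A B : Subset n} → A ⊆ B → IsSeparator G u v A → IsSeparator G u v B →
             ∣ B ∣ ≤ k → Reconfigurable G k u v A B
      grow {A} {B} A⊆B sepA sepB ∣B∣≤k = gmap id to-tar (interval-chain A⊆B)
        where
        to-tar : ∀ {X Y} → IntervalStep A B X Y → TARStep G k u v X Y
        to-tar ((A⊆X , X⊆B) , (A⊆Y , Y⊆B) , apart) =
          separator-between A⊆X X⊆B sepA sepB , separator-between A⊆Y Y⊆B sepA sepB ,
          apart , ℕ.⊔-lub (ℕ.≤-trans (p⊆q⇒∣p∣≤∣q∣ X⊆B) ∣B∣≤k)
                          (ℕ.≤-trans (p⊆q⇒∣p∣≤∣q∣ Y⊆B) ∣B∣≤k)

      shrink : {A B : Subset n} → A ⊆ B → IsSeparator G u v A → IsSeparator G u v B →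
               ∣ B ∣ ≤ k → Reconfigurable G k u v B A
      shrink A⊆B sepA sepB ∣B∣≤k = reverse tar-sym (grow A⊆B sepA sepB ∣B∣≤k)

      -- An edge M — M′ of H_uv is realised by the detour M → M ∪ M′ → M′.
      hpath⇒reconfigurable : {M M′ : Subset n} → HPath G k u v M M′ → Reconfigurable G k u v M M′
      hpath⇒reconfigurable ε = ε
      hpath⇒reconfigurable {M} (_◅_ {j = M′} ((sepM , _) , (sepM′ , _) , _ , ∣M∪M′∣≤k) path) =
        grow (p⊆p∪q M′) sepM sepM∪M′ ∣M∪M′∣≤k
        ◅◅ shrink (q⊆p∪q M M′) sepM′ sepM∪M′ ∣M∪M′∣≤k
        ◅◅ hpath⇒reconfigurable path
        where
        sepM∪M′ : IsSeparator G u v (M ∪ M′)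
        sepM∪M′ = separator-∪ sepM sepM′

      small-union⇒hpath : {M M′ : Subset n} → IsMinimalSeparator G u v M →
        IsMinimalSeparator G u v M′ → ∣ M ∪ M′ ∣ ≤ k → HPath G k u v M M′
      small-union⇒hpath {M} {M′} minM minM′ small with ≡-dec Bool._≟_ M M′
      ... | yes refl = ε
      ... | no M≢M′  = (minM , minM′ , M≢M′ , small) ◅ ε

      tar-tracks-minimal : {S S′ M : Subset n} → TARStep G k u v S S′ →
        IsMinimalSeparator G u v M → M ⊆ S →
        Σ[ M′ ∈ Subset n ] (IsMinimalSeparator G u v M′ × M′ ⊆ S′ × HPath G k u v M M′)
      tar-tracks-minimal {S} {S′} {M} (_ , sepS′ , apart , size) minM M⊆S
        with one-apart⇒comparable S S′ apart
      ... | inj₁ S⊆S′ = M , minM , ⊆-trans M⊆S S⊆S′ , ε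
      ... | inj₂ S′⊆S with minimal-inside S′ sepS′
      ...   | M′ , minM′ , M′⊆S′ = M′ , minM′ , M′⊆S′ , small-union⇒hpath minM minM′ small
        where
        small : ∣ M ∪ M′ ∣ ≤ k
        small = ℕ.≤-trans (p⊆q⇒∣p∣≤∣q∣ (∪-least M⊆S (⊆-trans M′⊆S′ S′⊆S)))
                          (ℕ.≤-trans (ℕ.m≤m⊔n ∣ S ∣ ∣ S′ ∣) size)

      reconfigurable-tracks-minimal : {S T M : Subset n} → Reconfigurable G k u v S T →
        IsMinimalSeparator G u v M → M ⊆ S →
        Σ[ M′ ∈ Subset n ] (IsMinimalSeparator G u v M′ × M′ ⊆ T × HPath G k u v M M′)
      reconfigurable-tracks-minimal {M = M} ε minM M⊆S = M , minM , M⊆S , ε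
      reconfigurable-tracks-minimal (tar ◅ tars) minM M⊆S with tar-tracks-minimal tar minM M⊆S
      ... | M₁ , minM₁ , M₁⊆ , path₁ with reconfigurable-tracks-minimal tars minM₁ M₁⊆
      ...   | M₂ , minM₂ , M₂⊆ , path₂ = M₂ , minM₂ , M₂⊆ , path₁ ◅◅ path₂

      LinkedInH : Subset n → Subset n → Set
      LinkedInH Sa Sb = Σ[ Sa′ ∈ Subset n ] Σ[ Sb′ ∈ Subset n ]
        (IsMinimalSeparator G u v Sa′ × IsMinimalSeparator G u v Sb′ ×
         Sa′ ⊆ Sa × Sb′ ⊆ Sb × HPath G k u v Sa′ Sb′)

      reconfigurable⇒linked : {Sa Sb : Subset n} → IsSeparator G u v Sa →
        Reconfigurable G k u v Sa Sb → LinkedInH Sa Sb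
      reconfigurable⇒linked {Sa} sepA tars with minimal-inside Sa sepA
      ... | Ma , minA , Ma⊆Sa with reconfigurable-tracks-minimal tars minA Ma⊆Sa
      ...   | Mb , minB , Mb⊆Sb , path = Ma , Mb , minA , minB , Ma⊆Sa , Mb⊆Sb , path

      linked⇒reconfigurable : {Sa Sb : Subset n} →
        IsSeparator G u v Sa → IsSeparator G u v Sb → ∣ Sa ∣ ≤ k → ∣ Sb ∣ ≤ k →
        LinkedInH Sa Sb → Reconfigurable G k u v Sa Sb
      linked⇒reconfigurable sepA sepB ∣Sa∣≤k ∣Sb∣≤k
                            (_ , _ , (sepA′ , _) , (sepB′ , _) , Sa′⊆Sa , Sb′⊆Sb , path) =
        shrink Sa′⊆Sa sepA′ sepA ∣Sa∣≤k
        ◅◅ hpath⇒reconfigurable path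
        ◅◅ grow Sb′⊆Sb sepB′ sepB ∣Sb∣≤k

lemma5 : {n : ℕ} (G : Graph n) (u v : Fin n) → u ≢ v → adj G u v ≡ false →
    (k : ℕ) → 1 ≤ k →
    (Sa Sb : Subset n) → IsSeparator G u v Sa → IsSeparator G u v Sb →
    ∣ Sa ∣ ≤ k → ∣ Sb ∣ ≤ k →
    Reconfigurable G k u v Sa Sb ⇔
      (Σ[ Sa′ ∈ Subset n ] Σ[ Sb′ ∈ Subset n ]
        (IsMinimalSeparator G u v Sa′ × IsMinimalSeparator G u v Sb′ ×
         Sa′ ⊆ Sa × Sb′ ⊆ Sb × HPath G k u v Sa′ Sb′))
lemma5 G u v _ _ k _ Sa Sb sepA sepB ∣Sa∣≤k ∣Sb∣≤k =
  mk⇔ (reconfigurable⇒linked G u v k sepA)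
      (linked⇒reconfigurable G u v k sepA sepB ∣Sa∣≤k ∣Sb∣≤k)
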